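{- Let $G=K_{r_1,\ldots,r_k}$ be a complete $k$-partite graph with $k\ge3$ and an odd number $n=\sum_i r_i$ of vertices, and let $C$ be a set of at least $\sum_{i=1}^k\lceil r_i/2\rceil$ colors. If, in the graph coloring game on $G$ with color set $C$, Alice plays according to strategy $(A3)$, then, whatever Bob does, the game ends with every vertex of $G$ colored.
   Context: Graph coloring game: given a graph $G$ and a finite set $C$ of colors, Alice and Bob alternately (Alice first) pick an uncolored vertex and give it a legal color, i.e. a color from $C$ not used on any neighbor. The game ends when all vertices are colored (Alice wins) or when no uncolored vertex has a legal color (Bob wins). $K_{r_1,\ldots,r_k}$ denotes the complete $k$-partite graph with parts (independent sets) $V_1,\ldots,V_k$, $|V_i|=r_i\ge1$, $r_1\ge\cdots\ge r_k$, every two vertices in different parts adjacent; the paper assumes that if $k\ge2$ then $r_1\ge 2$. A part is uncolored / partially colored / fully colored if none / some but not all / all of its vertices are colored. A "new color" is a color of $C$ not yet used on any vertex. Strategy $(A3)$ for Alice (for $n$ odd): (1) in her first move, pick an uncolored vertex of a part $V_i$ whose size $r_i$ is the smallest odd part size, and assign it a new color; (2) otherwise, if Bob's last move was at a vertex of some partially colored part $V_i$, pick another uncolored vertex of $V_i$ and give it the color Bob just used; (3) otherwise, if there is a partially colored part $V_i$, pick any uncolored vertex of it and give it a color already used on some vertex of $V_i$; (4) otherwise, pick any vertex of an uncolored part $V_i$ whose size is the smallest odd size among uncolored parts, and assign it a new color. -}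

module Defs where

open import Data.Nat using (ℕ; zero; suc; _+_; _≤_; ⌈_/2⌉)
open import Data.Nat.DivMod using (_%_)
open import Data.Fin using (Fin)
open import Data.Product using (Σ; ∃; _×_; _,_; proj₁)
open import Data.List using (List; []; _∷_)
open import Data.List.Membership.Propositional using (_∈_)
open import Relation.Nullary using (¬_)
open import Relation.Binary.PropositionalEquality using (_≡_; _≢_)
open import Function using (_∘_)

sumF : ∀ {k} → (Fin k → ℕ) → ℕ
sumF {zero}  f = 0
sumF {suc k} f = f Fin.zero + sumF (f ∘ Fin.suc)

Odd : ℕ → Set
Odd n = n % 2 ≡ 1

data Player : Set where
  alice bob : Player

-- The coloring game on the complete k-partite graph with parts V_i, |V_i| = r i,
-- colour set C = Fin m.
module Game {k : ℕ} (r : Fin k → ℕ) (m : ℕ) where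

  Vertex : Set
  Vertex = Σ (Fin k) (λ i → Fin (r i))

  Color : Set
  Color = Fin m

  Move : Set
  Move = Vertex × Color

  -- the list of moves played so far, most recent move first
  History : Set
  History = List Move

  Adjacent : Vertex → Vertex → Set
  Adjacent v w = proj₁ v ≢ proj₁ w

  ColoredWith : History → Vertex → Color → Set
  ColoredWith h v c = (v , c) ∈ h

  Colored : History → Vertex → Set
  Colored h v = ∃ λ c → ColoredWith h v c

  Uncolored : History → Vertex → Set
  Uncolored h v = ¬ Colored h v

  AllColored : History → Set
  AllColored h = ∀ v → Colored h v

  New : History → Color → Set
  New h c = ¬ (∃ λ v → ColoredWith h v c)

  UsedOnPart : History → Fin k → Color → Set
  UsedOnPart h i c = ∃ λ j → ColoredWith h (i , j) c

  Legal : History → Move → Set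
  Legal h (v , c) = Uncolored h v × (∀ w → Adjacent v w → ¬ ColoredWith h w c)

  PartUncolored : History → Fin k → Set
  PartUncolored h i = ∀ j → Uncolored h (i , j)

  PartPartial : History → Fin k → Set
  PartPartial h i = (∃ λ j → Colored h (i , j)) × (∃ λ j → Uncolored h (i , j))

  SmallestOdd : Fin k → Set
  SmallestOdd i = Odd (r i) × (∀ i' → Odd (r i') → r i ≤ r i')

  SmallestOddUncolored : History → Fin k → Set
  SmallestOddUncolored h i =
    PartUncolored h i × Odd (r i) ×
    (∀ i' → PartUncolored h i' → Odd (r i') → r i ≤ r i')

  -- moves conforming to strategy (A3); Alice's turns are at [] (her first move)
  -- and right after a move of Bob (the head of the history)
  data A3 : History → Move → Set where
    step1 : ∀ {v c} → SmallestOdd (proj₁ v) → New [] c → A3 [] (v , c)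
    step2 : ∀ {h b cb v} →
            PartPartial ((b , cb) ∷ h) (proj₁ b) →
            proj₁ v ≡ proj₁ b → Uncolored ((b , cb) ∷ h) v →
            A3 ((b , cb) ∷ h) (v , cb)
    step3 : ∀ {h b cb v c} →
            ¬ PartPartial ((b , cb) ∷ h) (proj₁ b) →
            PartPartial ((b , cb) ∷ h) (proj₁ v) →
            Uncolored ((b , cb) ∷ h) v →
            UsedOnPart ((b , cb) ∷ h) (proj₁ v) c →
            A3 ((b , cb) ∷ h) (v , c)
    step4 : ∀ {h b cb v c} →
            ¬ PartPartial ((b , cb) ∷ h) (proj₁ b) →
            (∀ i → ¬ PartPartial ((b , cb) ∷ h) i) →
            SmallestOddUncolored ((b , cb) ∷ h) (proj₁ v) →
            New ((b , cb) ∷ h) c →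
            A3 ((b , cb) ∷ h) (v , c)

  data Reach : History → Player → Set where
    start : Reach [] alice
    aliceMoves : ∀ {h mv} → Reach h alice → A3 h mv → Legal h mv → Reach (mv ∷ h) bob
    bobMoves   : ∀ {h mv} → Reach h bob → Legal h mv → Reach (mv ∷ h) alice

  CanMove : History → Player → Set
  CanMove h alice = ∃ λ mv → A3 h mv × Legal h mv
  CanMove h bob   = ∃ λ mv → Legal h mv

-- Any two parts are completely joined, so each colour stays inside one part, and an
-- uncoloured vertex of V_i can always be coloured with a colour already used on V_i or
-- with a new one, provided a new colour is left.  Let d_i be the number of colours and
-- c_i the number of coloured vertices of V_i.  Strategy (A3) keeps 2 d_i ≤ c_i + (r_i mod 2)
-- for every part whenever Bob is to move: Alice answers inside Bob's part with Bob's colour,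
-- continues a partial part with one of its colours, and opens a part with a new colour
-- only if its size is odd (on a part Bob has just filled the bound is restored because
-- r_i + (r_i mod 2) is even).  Bob's move breaks the bound by at most one, which still
-- gives d_i ≤ ⌈r_i/2⌉; hence Σ d_i < Σ ⌈r_i/2⌉ ≤ |C| as long as some part carries no
-- colour, and a new colour is available whenever one is needed.  When Alice has to open
-- a part, no part is partial and an even number of vertices is coloured, so as n is odd
-- some uncoloured part has odd size.
module Submission where

open import Defs
open import Algebra.Properties.CommutativeSemigroup using (interchange)
open import Data.Fin using (Fin; zero; suc; _≟_)
open import Data.Fin.Properties using (any?; all?; ¬∀⟶∃¬; suc-injective)
open import Data.List using ([]; _∷_; length; filter; allFin)
open import Data.List.Extrema.Nat using (argmin; argmin-all; f[argmin]≤f[xs])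
import Data.List.Membership.DecPropositional as DecMembership
open import Data.List.Membership.Propositional.Properties using (∈-filter⁺; ∈-allFin)
open import Data.List.Relation.Unary.All as All using ()
open import Data.List.Relation.Unary.All.Properties using (all-filter)
open import Data.List.Relation.Unary.Any using (here; there)
import Data.Nat as ℕ
open import Data.Nat using (ℕ; zero; suc; _+_; _*_; _∸_; _%_; _≤_; _<_; z≤n; s≤s; ⌈_/2⌉)
open import Data.Nat.Properties
  using ( module ≤-Reasoning; ≤-refl; ≤-trans; ≤-pred; ≤-reflexive; <-≤-trans; <-irrefl
        ; n≤1+n; m≤n⇒m≤1+n; m≤m+n; m≤n+m; m+[n∸m]≡n; n∸n≡0
        ; +-mono-≤; +-monoˡ-≤; +-monoʳ-≤; +-mono-<-≤; +-mono-≤-<; +-suc; +-commutativeSemigroup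
        ; *-suc; *-zeroʳ; *-identityʳ; *-monoʳ-≤; *-cancelˡ-< )
open import Data.Product using (∃; _×_; _,_; proj₁; proj₂)
open import Data.Product.Properties using (≡-dec)
open import Data.Sum using (_⊎_; inj₁; inj₂; [_,_]′)
open import Function using (_∘_; _⇔_; mk⇔; Equivalence)
open import Relation.Binary.Definitions using (DecidableEquality)
open import Relation.Binary.PropositionalEquality
open import Relation.Nullary using (Dec; yes; no; ¬_; ¬?; contradiction)
open import Relation.Nullary.Decidable using (_×-dec_; decidable-stable)
open import Relation.Unary using (Decidable)

open Equivalence using (to; from)

sumF-cong : ∀ {n} {f g : Fin n → ℕ} → (∀ i → f i ≡ g i) → sumF f ≡ sumF g
sumF-cong {zero}  f≡g = refl
sumF-cong {suc n} f≡g = cong₂ _+_ (f≡g zero) (sumF-cong (f≡g ∘ suc))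

sumF-mono-≤ : ∀ {n} {f g : Fin n → ℕ} → (∀ i → f i ≤ g i) → sumF f ≤ sumF g
sumF-mono-≤ {zero}  f≤g = z≤n
sumF-mono-≤ {suc n} f≤g = +-mono-≤ (f≤g zero) (sumF-mono-≤ (f≤g ∘ suc))

sumF-mono-< : ∀ {n} {f g : Fin n → ℕ} → (∀ i → f i ≤ g i) → ∀ j → f j < g j → sumF f < sumF g
sumF-mono-< f≤g zero    fj<gj = +-mono-<-≤ fj<gj (sumF-mono-≤ (f≤g ∘ suc))
sumF-mono-< f≤g (suc j) fj<gj = +-mono-≤-< (f≤g zero) (sumF-mono-< (f≤g ∘ suc) j fj<gj)

f≤sumF : ∀ {n} (f : Fin n → ℕ) i → f i ≤ sumF f
f≤sumF f zero    = m≤m+n (f zero) _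
f≤sumF f (suc i) = ≤-trans (f≤sumF (f ∘ suc) i) (m≤n+m _ (f zero))

sumF-const : ∀ n c → sumF {n} (λ _ → c) ≡ n * c
sumF-const zero    c = refl
sumF-const (suc n) c = cong (c +_) (sumF-const n c)

sumF-+ : ∀ {n} (f g : Fin n → ℕ) → sumF (λ i → f i + g i) ≡ sumF f + sumF g
sumF-+ {zero}  f g = refl
sumF-+ {suc n} f g = trans (cong (f zero + g zero +_) (sumF-+ (f ∘ suc) (g ∘ suc)))
                           (interchange +-commutativeSemigroup (f zero) (g zero) _ _)

sumF-comm : ∀ {m n} (f : Fin m → Fin n → ℕ) →
            sumF (λ i → sumF (f i)) ≡ sumF (λ j → sumF (λ i → f i j))
sumF-comm {zero}  {n} f = sym (trans (sumF-const n 0) (*-zeroʳ n))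
sumF-comm {suc m}     f = trans (cong (sumF (f zero) +_) (sumF-comm (f ∘ suc)))
                                (sym (sumF-+ (f zero) _))

sumF-suc-at : ∀ {n} {f g : Fin n → ℕ} i₀ → g i₀ ≡ suc (f i₀) → (∀ i → i ≢ i₀ → g i ≡ f i) →
              sumF g ≡ suc (sumF f)
sumF-suc-at zero       g≡ g≡f = cong₂ _+_ g≡ (sumF-cong (λ i → g≡f (suc i) λ ()))
sumF-suc-at {f = f} (suc i₀) g≡ g≡f =
  trans (cong₂ _+_ (g≡f zero λ ()) (sumF-suc-at i₀ g≡ (λ i i≢i₀ → g≡f (suc i) (i≢i₀ ∘ suc-injective))))
        (+-suc (f zero) _)

indicator : {P : Set} → Dec P → ℕ
indicator (yes _) = 1
indicator (no _)  = 0

indicator≤1 : {P : Set} (P? : Dec P) → indicator P? ≤ 1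
indicator≤1 (yes _) = ≤-refl
indicator≤1 (no _)  = z≤n

indicator-yes : {P : Set} (P? : Dec P) → P → indicator P? ≡ 1
indicator-yes (yes _) _ = refl
indicator-yes (no ¬p) p = contradiction p ¬p

indicator-no : {P : Set} (P? : Dec P) → ¬ P → indicator P? ≡ 0
indicator-no (yes p) ¬p = contradiction p ¬p
indicator-no (no _)  _  = refl

indicator-cong : {P Q : Set} (P? : Dec P) (Q? : Dec Q) → P ⇔ Q → indicator P? ≡ indicator Q?
indicator-cong P? (yes q) P⇔Q = indicator-yes P? (from P⇔Q q)
indicator-cong P? (no ¬q) P⇔Q = indicator-no P? (¬q ∘ to P⇔Q)

count : ∀ {n} {P : Fin n → Set} → Decidable P → ℕ
count P? = sumF (λ x → indicator (P? x))

count-cong : ∀ {n} {P Q : Fin n → Set} (P? : Decidable P) (Q? : Decidable Q) →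
             (∀ x → P x ⇔ Q x) → count P? ≡ count Q?
count-cong P? Q? P⇔Q = sumF-cong (λ x → indicator-cong (P? x) (Q? x) (P⇔Q x))

module _ {n} {P : Fin n → Set} (P? : Decidable P) where

  count≤n : count P? ≤ n
  count≤n = ≤-trans (sumF-mono-≤ (indicator≤1 ∘ P?))
                    (≤-reflexive (trans (sumF-const n 1) (*-identityʳ n)))

  count-full : (∀ x → P x) → count P? ≡ n
  count-full all = trans (sumF-cong (λ x → indicator-yes (P? x) (all x)))
                         (trans (sumF-const n 1) (*-identityʳ n))

  count-empty : (∀ x → ¬ P x) → count P? ≡ 0
  count-empty none = trans (sumF-cong (λ x → indicator-no (P? x) (none x)))
                           (trans (sumF-const n 0) (*-zeroʳ n))

  count<n⇒∃¬ : count P? < n → ∃ λ x → ¬ P x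
  count<n⇒∃¬ lt = ¬∀⟶∃¬ n P P? (λ all → <-irrefl (count-full all) lt)

  indicator-any≤count : indicator (any? P?) ≤ count P?
  indicator-any≤count with any? P?
  ... | yes (x , p) = ≤-trans (≤-reflexive (sym (indicator-yes (P? x) p))) (f≤sumF _ x)
  ... | no _        = z≤n

  module _ {Q : Fin n → Set} (Q? : Decidable Q) {x₀} (Q⇔≡⊎P : ∀ x → Q x ⇔ (x ≡ x₀ ⊎ P x)) where

    private
      Q⇔P : ∀ {x} → (x ≡ x₀ → P x) → Q x ⇔ P x
      Q⇔P {x} P-at-x₀ = mk⇔ ([ P-at-x₀ , (λ p → p) ]′ ∘ to (Q⇔≡⊎P x)) (from (Q⇔≡⊎P x) ∘ inj₂)

    count-insert-absent : ¬ P x₀ → count Q? ≡ suc (count P?)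
    count-insert-absent ¬Px₀ = sumF-suc-at x₀
      (trans (indicator-yes (Q? x₀) (from (Q⇔≡⊎P x₀) (inj₁ refl)))
             (cong suc (sym (indicator-no (P? x₀) ¬Px₀))))
      (λ x x≢x₀ → indicator-cong (Q? x) (P? x) (Q⇔P (λ x≡x₀ → contradiction x≡x₀ x≢x₀)))

    count-insert-present : P x₀ → count Q? ≡ count P?
    count-insert-present Px₀ = count-cong Q? P? (λ _ → Q⇔P λ { refl → Px₀ })

    count-insert-≤ : count Q? ≤ suc (count P?)
    count-insert-≤ with P? x₀
    ... | no ¬Px₀ = ≤-reflexive (count-insert-absent ¬Px₀)
    ... | yes Px₀ = ≤-trans (≤-reflexive (count-insert-present Px₀)) (n≤1+n _)

argmin-∃ : ∀ {n} {P : Fin n → Set} → Decidable P → (f : Fin n → ℕ) → ∃ P →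
           ∃ λ i → P i × (∀ j → P j → f i ≤ f j)
argmin-∃ {n} P? f (i₀ , Pi₀) =
  argmin f i₀ xs ,
  argmin-all f Pi₀ (all-filter P? (allFin n)) ,
  λ j Pj → All.lookup (f[argmin]≤f[xs] i₀ xs) (∈-filter⁺ P? (∈-allFin j) Pj)
  where xs = filter P? (allFin n)

Even : ℕ → Set
Even n = ∃ λ q → n ≡ q * 2

odd? : ∀ n → Dec (Odd n)
odd? n = n % 2 ℕ.≟ 1

odd⇒Fin : ∀ {n} → Odd n → Fin n
odd⇒Fin {suc n} _ = zero

odd-+ : ∀ m {n} → Odd (m + n) → Odd m ⊎ Odd n
odd-+ zero          o = inj₂ o
odd-+ (suc zero)    o = inj₁ refl
odd-+ (suc (suc m)) o = odd-+ m o

odd-even+ : ∀ {m n} → Even m → Odd (m + n) → Odd n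
odd-even+ (zero  , refl) o = o
odd-even+ (suc q , refl) o = odd-even+ (q , refl) o

odd-sumF : ∀ {n} (f : Fin n → ℕ) → Odd (sumF f) → ∃ λ i → Odd (f i)
odd-sumF {zero}  f ()
odd-sumF {suc n} f o with odd-+ (f zero) o
... | inj₁ o₀ = zero , o₀
... | inj₂ oₛ with odd-sumF (f ∘ suc) oₛ
...   | i , oᵢ = suc i , oᵢ

n+n%2≡2*⌈n/2⌉ : ∀ n → n + n % 2 ≡ 2 * ⌈ n /2⌉
n+n%2≡2*⌈n/2⌉ zero          = refl
n+n%2≡2*⌈n/2⌉ (suc zero)    = refl
n+n%2≡2*⌈n/2⌉ (suc (suc n)) = trans (cong (2 +_) (n+n%2≡2*⌈n/2⌉ n)) (sym (*-suc 2 ⌈ n /2⌉))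

2*m≤1+2*n⇒m≤n : ∀ {m n} → 2 * m ≤ suc (2 * n) → m ≤ n
2*m≤1+2*n⇒m≤n {m} {n} le = ≤-pred (*-cancelˡ-< 2 m (suc n) (subst (2 * m <_) (sym (*-suc 2 n)) (s≤s le)))

2*m≤1+n+n%2⇒m≤⌈n/2⌉ : ∀ {m} n → 2 * m ≤ suc (n + n % 2) → m ≤ ⌈ n /2⌉
2*m≤1+n+n%2⇒m≤⌈n/2⌉ {m} n le = 2*m≤1+2*n⇒m≤n (subst (λ x → 2 * m ≤ suc x) (n+n%2≡2*⌈n/2⌉ n) le)

2*m≤1+n+n%2⇒2*m≤n+n%2 : ∀ {m} n → 2 * m ≤ suc (n + n % 2) → 2 * m ≤ n + n % 2
2*m≤1+n+n%2⇒2*m≤n+n%2 {m} n le =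
  subst (2 * m ≤_) (sym (n+n%2≡2*⌈n/2⌉ n)) (*-monoʳ-≤ 2 (2*m≤1+n+n%2⇒m≤⌈n/2⌉ {m} n le))

0<⌈n/2⌉ : ∀ {n} → Fin n → 0 < ⌈ n /2⌉
0<⌈n/2⌉ {suc n} _ = s≤s z≤n

module _ {k : ℕ} (r : Fin k → ℕ) (m : ℕ) where
  open Game r m

  _≟ᵐ_ : DecidableEquality Move
  _≟ᵐ_ = ≡-dec (≡-dec _≟_ _≟_) _≟_

  open DecMembership _≟ᵐ_ using (_∈?_)

  coloredWith? : ∀ h v c → Dec (ColoredWith h v c)
  coloredWith? h v c = (v , c) ∈? h

  colored? : ∀ h v → Dec (Colored h v)
  colored? h v = any? (coloredWith? h v)

  usedOnPart? : ∀ h i c → Dec (UsedOnPart h i c)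
  usedOnPart? h i c = any? (λ j → coloredWith? h (i , j) c)

  partPartial? : ∀ h i → Dec (PartPartial h i)
  partPartial? h i = any? (λ j → colored? h (i , j)) ×-dec any? (λ j → ¬? (colored? h (i , j)))

  partUncolored? : ∀ h i → Dec (PartUncolored h i)
  partUncolored? h i = all? (λ j → ¬? (colored? h (i , j)))

  allColored⊎uncolored : ∀ h → AllColored h ⊎ ∃ (Uncolored h)
  allColored⊎uncolored h with any? (λ i → any? (λ j → ¬? (colored? h (i , j))))
  ... | yes (i , j , u) = inj₂ ((i , j) , u)
  ... | no none         = inj₁ λ (i , j) → decidable-stable (colored? h (i , j)) (λ u → none (i , j , u))

  partFull⊎partUncolored : ∀ {h i} → ¬ PartPartial h i → (∀ j → Colored h (i , j)) ⊎ PartUncolored h i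
  partFull⊎partUncolored {h} {i} ¬partial with all? (λ j → colored? h (i , j))
  ... | yes full = inj₁ full
  ... | no ¬full = inj₂ λ j c → ¬partial ((j , c) , ¬∀⟶∃¬ _ _ (λ j → colored? h (i , j)) ¬full)

  coloredCount colorCount : History → Fin k → ℕ
  coloredCount h i = count (λ j → colored? h (i , j))
  colorCount   h i = count (usedOnPart? h i)

  module _ {h : History} {i : Fin k} {j₀ : Fin (r i)} {c : Color} where

    colored-∷-same : ∀ j → Colored (((i , j₀) , c) ∷ h) (i , j) ⇔ (j ≡ j₀ ⊎ Colored h (i , j))
    colored-∷-same j = mk⇔ (λ { (_ , here refl) → inj₁ refl ; (c′ , there p) → inj₂ (c′ , p) })
                           (λ { (inj₁ refl) → c , here refl ; (inj₂ (c′ , p)) → c′ , there p })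

    usedOnPart-∷-same : ∀ c′ → UsedOnPart (((i , j₀) , c) ∷ h) i c′ ⇔ (c′ ≡ c ⊎ UsedOnPart h i c′)
    usedOnPart-∷-same c′ = mk⇔ (λ { (_ , here refl) → inj₁ refl ; (j , there p) → inj₂ (j , p) })
                               (λ { (inj₁ refl) → j₀ , here refl ; (inj₂ (j , p)) → j , there p })

  module _ {h : History} {i′ : Fin k} {j′ : Fin (r i′)} {c : Color} {i : Fin k} (i′≢i : i′ ≢ i) where

    colored-∷-other : ∀ j → Colored (((i′ , j′) , c) ∷ h) (i , j) ⇔ Colored h (i , j)
    colored-∷-other j = mk⇔ (λ { (_ , here refl) → contradiction refl i′≢i ; (c′ , there p) → c′ , p })
                            (λ (c′ , p) → c′ , there p)

    usedOnPart-∷-other : ∀ c′ → UsedOnPart (((i′ , j′) , c) ∷ h) i c′ ⇔ UsedOnPart h i c′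
    usedOnPart-∷-other c′ = mk⇔ (λ { (_ , here refl) → contradiction refl i′≢i ; (j , there p) → j , p })
                                (λ (j , p) → j , there p)

    coloredCount-∷-other : coloredCount (((i′ , j′) , c) ∷ h) i ≡ coloredCount h i
    coloredCount-∷-other = count-cong _ _ colored-∷-other

    colorCount-∷-other : colorCount (((i′ , j′) , c) ∷ h) i ≡ colorCount h i
    colorCount-∷-other = count-cong _ _ usedOnPart-∷-other

  module _ {h : History} {i : Fin k} {j : Fin (r i)} {c : Color} where

    coloredCount-∷-same : Uncolored h (i , j) → coloredCount (((i , j) , c) ∷ h) i ≡ suc (coloredCount h i)
    coloredCount-∷-same = count-insert-absent _ _ colored-∷-same

    colorCount-∷-same : colorCount (((i , j) , c) ∷ h) i ≤ suc (colorCount h i)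
    colorCount-∷-same = count-insert-≤ _ _ usedOnPart-∷-same

    colorCount-∷-reuse : UsedOnPart h i c → colorCount (((i , j) , c) ∷ h) i ≡ colorCount h i
    colorCount-∷-reuse = count-insert-present _ _ usedOnPart-∷-same

  colorCount-uncolored : ∀ {h i} → PartUncolored h i → colorCount h i ≡ 0
  colorCount-uncolored {h} {i} unc = count-empty (usedOnPart? h i) λ c (j , p) → unc j (c , p)

  coloredCount-uncolored : ∀ {h i} → PartUncolored h i → coloredCount h i ≡ 0
  coloredCount-uncolored {h} {i} unc = count-empty (λ j → colored? h (i , j)) unc

  ColorsWithinParts : History → Set
  ColorsWithinParts h = ∀ {v w c} → ColoredWith h v c → ColoredWith h w c → proj₁ v ≡ proj₁ w

  colorsWithinParts-∷ : ∀ {h mv} → ColorsWithinParts h → Legal h mv → ColorsWithinParts (mv ∷ h)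
  colorsWithinParts-∷ within (_ , proper) (here refl) (here refl) = refl
  colorsWithinParts-∷ within (_ , proper) {v} {w} (here refl) (there q) with proj₁ v ≟ proj₁ w
  ... | yes same = same
  ... | no  diff = contradiction q (proper w diff)
  colorsWithinParts-∷ within (_ , proper) {v} {w} (there p) (here refl) with proj₁ w ≟ proj₁ v
  ... | yes same = sym same
  ... | no  diff = contradiction p (proper v diff)
  colorsWithinParts-∷ within _ (there p) (there q) = within p q

  legal-reuse : ∀ {h v c} → ColorsWithinParts h → Uncolored h v → UsedOnPart h (proj₁ v) c → Legal h (v , c)
  legal-reuse within u (_ , p) = u , λ w adjacent q → adjacent (within p q)

  legal-new : ∀ {h v c} → Uncolored h v → New h c → Legal h (v , c)
  legal-new u new = u , λ w _ q → new (w , q)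

  sumF-coloredCount-∷ : ∀ {h mv} → Legal h mv → sumF (coloredCount (mv ∷ h)) ≡ suc (sumF (coloredCount h))
  sumF-coloredCount-∷ {mv = ((i , j) , c)} (u , _) =
    sumF-suc-at i (coloredCount-∷-same u) (λ i′ i′≢i → coloredCount-∷-other (i′≢i ∘ sym))

  new-color : ∀ {h} → sumF (colorCount h) < m → ∃ (New h)
  new-color {h} lt with count<n⇒∃¬ usedSomewhere? (≤-trans (s≤s usedSomewhere≤) lt)
    where
    usedSomewhere? : ∀ c → Dec (∃ λ i → UsedOnPart h i c)
    usedSomewhere? c = any? (λ i → usedOnPart? h i c)
    usedSomewhere≤ : count usedSomewhere? ≤ sumF (colorCount h)
    usedSomewhere≤ = ≤-trans (sumF-mono-≤ (λ c → indicator-any≤count (λ i → usedOnPart? h i c)))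
                             (≤-reflexive (sumF-comm (λ c i → indicator (usedOnPart? h i c))))
  ... | c , unused = c , λ ((i , j) , p) → unused (i , j , p)

  Balanced NearlyBalanced : History → Fin k → Set
  Balanced       h i = 2 * colorCount h i ≤ coloredCount h i + r i % 2
  NearlyBalanced h i = 2 * colorCount h i ≤ suc (coloredCount h i + r i % 2)

  balanced⇒nearlyBalanced : ∀ {h i} → Balanced h i → NearlyBalanced h i
  balanced⇒nearlyBalanced = m≤n⇒m≤1+n

  nearlyBalanced⇒colorCount≤ : ∀ {h i} → NearlyBalanced h i → colorCount h i ≤ ⌈ r i /2⌉
  nearlyBalanced⇒colorCount≤ {h} {i} nb =
    2*m≤1+n+n%2⇒m≤⌈n/2⌉ (r i) (≤-trans nb (s≤s (+-monoˡ-≤ (r i % 2) (count≤n _))))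

  new-color-available : ∀ {h i} → (∀ i → NearlyBalanced h i) → sumF (λ i → ⌈ r i /2⌉) ≤ m →
                     colorCount h i ≡ 0 → Fin (r i) → ∃ (New h)
  new-color-available {h} {i} nb budget unused j =
    new-color (<-≤-trans (sumF-mono-< (nearlyBalanced⇒colorCount≤ ∘ nb) i fewer-here) budget)
    where
    fewer-here : colorCount h i < ⌈ r i /2⌉
    fewer-here = subst (_< ⌈ r i /2⌉) (sym unused) (0<⌈n/2⌉ j)

  balanced-uncolored : ∀ {h i} → PartUncolored h i → Balanced h i
  balanced-uncolored {h} {i} unc =
    subst (λ d → 2 * d ≤ coloredCount h i + r i % 2) (sym (colorCount-uncolored unc)) z≤n

  balanced-full : ∀ {h i} → (∀ j → Colored h (i , j)) → NearlyBalanced h i → Balanced h i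
  balanced-full {h} {i} full nb =
    subst (λ n → 2 * colorCount h i ≤ n + r i % 2) (sym all-colored)
          (2*m≤1+n+n%2⇒2*m≤n+n%2 {colorCount h i} (r i)
            (subst (λ n → 2 * colorCount h i ≤ suc (n + r i % 2)) all-colored nb))
    where
    all-colored : coloredCount h i ≡ r i
    all-colored = count-full (λ j → colored? h (i , j)) full

  balanced-∷-other : ∀ {h i′ j′ c i} → i′ ≢ i → Balanced h i → Balanced (((i′ , j′) , c) ∷ h) i
  balanced-∷-other {i = i} i′≢i =
    subst₂ (λ d n → 2 * d ≤ n + r i % 2) (sym (colorCount-∷-other i′≢i)) (sym (coloredCount-∷-other i′≢i))

  module _ {h : History} {i : Fin k} {j : Fin (r i)} {c : Color} (u : Uncolored h (i , j)) where

    nearlyBalanced-∷ : Balanced h i → NearlyBalanced (((i , j) , c) ∷ h) i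
    nearlyBalanced-∷ b = begin
      2 * colorCount (((i , j) , c) ∷ h) i  ≤⟨ *-monoʳ-≤ 2 colorCount-∷-same ⟩
      2 * suc (colorCount h i)             ≡⟨ *-suc 2 _ ⟩
      2 + 2 * colorCount h i               ≤⟨ +-monoʳ-≤ 2 b ⟩
      2 + (coloredCount h i + r i % 2)     ≡⟨ cong (λ n → suc (n + r i % 2)) (sym (coloredCount-∷-same u)) ⟩
      suc (coloredCount (((i , j) , c) ∷ h) i + r i % 2) ∎
      where open ≤-Reasoning

    balanced-∷-reuse : UsedOnPart h i c → NearlyBalanced h i → Balanced (((i , j) , c) ∷ h) i
    balanced-∷-reuse used = subst₂ (λ d n → 2 * d ≤ n + r i % 2)
                                   (sym (colorCount-∷-reuse used)) (sym (coloredCount-∷-same u))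

  balanced-∷-open : ∀ {h i j c} → PartUncolored h i → Odd (r i) → Balanced (((i , j) , c) ∷ h) i
  balanced-∷-open {h} {i} {j} {c} unc odd = begin
    2 * colorCount (((i , j) , c) ∷ h) i ≤⟨ *-monoʳ-≤ 2 one-color ⟩
    1 + 1                                ≡⟨ cong₂ _+_ (sym one-vertex) (sym odd) ⟩
    coloredCount (((i , j) , c) ∷ h) i + r i % 2 ∎
    where
    open ≤-Reasoning
    one-color : colorCount (((i , j) , c) ∷ h) i ≤ 1
    one-color = subst (λ d → colorCount (((i , j) , c) ∷ h) i ≤ suc d)
                      (colorCount-uncolored unc) colorCount-∷-same
    one-vertex : coloredCount (((i , j) , c) ∷ h) i ≡ 1
    one-vertex = trans (coloredCount-∷-same (unc j)) (cong suc (coloredCount-uncolored unc))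

  balanced-∷ : ∀ {h i j c} → Balanced (((i , j) , c) ∷ h) i → (∀ i′ → i ≢ i′ → Balanced h i′) →
               ∀ i′ → Balanced (((i , j) , c) ∷ h) i′
  balanced-∷ {i = i} here-balanced elsewhere i′ with i ≟ i′
  ... | yes refl = here-balanced
  ... | no  i≢i′ = balanced-∷-other i≢i′ (elsewhere i′ i≢i′)

  nearlyBalanced-after : ∀ {h mv} → (∀ i → Balanced h i) → Legal h mv → ∀ i → NearlyBalanced (mv ∷ h) i
  nearlyBalanced-after {mv = ((i , j) , c)} bal (u , _) i′ with i ≟ i′
  ... | yes refl = nearlyBalanced-∷ u (bal i)
  ... | no  i≢i′ = balanced⇒nearlyBalanced (balanced-∷-other i≢i′ (bal i′))

  partUncolored-[] : ∀ {i} → PartUncolored [] i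
  partUncolored-[] _ (_ , ())

  balanced-after-first-move : ∀ {mv} → A3 [] mv → ∀ i → Balanced (mv ∷ []) i
  balanced-after-first-move (step1 (odd , _) _) =
    balanced-∷ (balanced-∷-open partUncolored-[] odd) (λ _ _ → balanced-uncolored partUncolored-[])

  balanced-after-round : ∀ {h ib jb cb mv} → (∀ i → Balanced h i) → Legal h ((ib , jb) , cb) →
                         A3 (((ib , jb) , cb) ∷ h) mv → ∀ i → Balanced (mv ∷ ((ib , jb) , cb) ∷ h) i
  balanced-after-round {h} {ib} {jb} {cb} {((ia , ja) , ca)} bal legal a = after a
    where
    h₁ = ((ib , jb) , cb) ∷ h

    nearly : ∀ i → NearlyBalanced h₁ i
    nearly = nearlyBalanced-after bal legal

    balanced-unless-partial : ¬ PartPartial h₁ ib → ∀ i → Balanced h₁ i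
    balanced-unless-partial ¬partial i with ib ≟ i
    ... | no ib≢i = balanced-∷-other ib≢i (bal i)
    ... | yes refl with partFull⊎partUncolored ¬partial
    ...   | inj₁ full = balanced-full full (nearly ib)
    ...   | inj₂ unc  = contradiction (cb , here refl) (unc jb)

    after : A3 h₁ ((ia , ja) , ca) → ∀ i → Balanced (((ia , ja) , ca) ∷ h₁) i
    after (step2 _ refl u) =
      balanced-∷ (balanced-∷-reuse u (jb , here refl) (nearly ib)) (λ i ib≢i → balanced-∷-other ib≢i (bal i))
    after (step3 ¬partial _ u used) =
      balanced-∷ (balanced-∷-reuse u used (nearly ia)) (λ i _ → balanced-unless-partial ¬partial i)
    after (step4 ¬partial _ (unc , odd , _) _) =
      balanced-∷ (balanced-∷-open unc odd) (λ i _ → balanced-unless-partial ¬partial i)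

  balanced-at-bob : ∀ {h} → Reach h bob → ∀ i → Balanced h i
  balanced-at-bob (aliceMoves start a _)                = balanced-after-first-move a
  balanced-at-bob (aliceMoves (bobMoves R legal) a _) = balanced-after-round (balanced-at-bob R) legal a

  nearlyBalanced-at-alice : ∀ {h} → Reach h alice → ∀ i → NearlyBalanced h i
  nearlyBalanced-at-alice start              = λ _ → balanced⇒nearlyBalanced (balanced-uncolored partUncolored-[])
  nearlyBalanced-at-alice (bobMoves R legal) = nearlyBalanced-after (balanced-at-bob R) legal

  reach-colorsWithinParts : ∀ {h p} → Reach h p → ColorsWithinParts h
  reach-colorsWithinParts start                = λ ()
  reach-colorsWithinParts (aliceMoves R _ legal) = colorsWithinParts-∷ (reach-colorsWithinParts R) legal
  reach-colorsWithinParts (bobMoves R legal)     = colorsWithinParts-∷ (reach-colorsWithinParts R) legal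

  reach-sumF-coloredCount : ∀ {h p} → Reach h p → sumF (coloredCount h) ≡ length h
  reach-sumF-coloredCount start =
    trans (sumF-cong {k} (λ i → coloredCount-uncolored {[]} {i} partUncolored-[])) (trans (sumF-const k 0) (*-zeroʳ k))
  reach-sumF-coloredCount (aliceMoves R _ legal) =
    trans (sumF-coloredCount-∷ legal) (cong suc (reach-sumF-coloredCount R))
  reach-sumF-coloredCount (bobMoves R legal) =
    trans (sumF-coloredCount-∷ legal) (cong suc (reach-sumF-coloredCount R))

  length-at-alice : ∀ {h} → Reach h alice → Even (length h)
  length-at-bob   : ∀ {h} → Reach h bob → Even (suc (length h))
  length-at-alice start              = 0 , refl
  length-at-alice (bobMoves R _)     = length-at-bob R
  length-at-bob   (aliceMoves R _ _) = let q , e = length-at-alice R in suc q , cong (2 +_) e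

  uncoloredCount : History → Fin k → ℕ
  uncoloredCount h i = r i ∸ coloredCount h i

  sumF-colored+uncolored : ∀ h → sumF (coloredCount h) + sumF (uncoloredCount h) ≡ sumF r
  sumF-colored+uncolored h = begin
    sumF (coloredCount h) + sumF (uncoloredCount h)     ≡⟨ sumF-+ (coloredCount h) (uncoloredCount h) ⟨
    sumF (λ i → coloredCount h i + uncoloredCount h i)  ≡⟨ sumF-cong {k} (λ i → m+[n∸m]≡n (count≤n _)) ⟩
    sumF r                                              ∎
    where open ≡-Reasoning

  odd-uncolored-part : ∀ {h} → Even (sumF (coloredCount h)) → Odd (sumF r) → (∀ i → ¬ PartPartial h i) →
                       ∃ λ i → PartUncolored h i × Odd (r i)
  odd-uncolored-part {h} even odd ¬partial
    with odd-sumF (uncoloredCount h) (odd-even+ even (subst Odd (sym (sumF-colored+uncolored h)) odd))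
  ... | i , odd-rest with partFull⊎partUncolored (¬partial i)
  ...   | inj₁ full = contradiction (subst Odd (trans (cong (r i ∸_) (count-full _ full)) (n∸n≡0 (r i))) odd-rest) λ ()
  ...   | inj₂ unc  = i , unc , subst (λ n → Odd (r i ∸ n)) (coloredCount-uncolored unc) odd-rest

  bob-can-move : ∀ {h} → ColorsWithinParts h → (∀ i → NearlyBalanced h i) →
                 sumF (λ i → ⌈ r i /2⌉) ≤ m → ∃ (Uncolored h) → CanMove h bob
  bob-can-move {h} within nb budget ((i , j) , u) with any? (usedOnPart? h i)
  ... | yes (c , used) = ((i , j) , c) , legal-reuse within u used
  ... | no unused with new-color-available nb budget (count-empty (usedOnPart? h i) (λ c used → unused (c , used))) j
  ...   | c , new = ((i , j) , c) , legal-new u new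

  module _ {h : History} {b : Vertex} {cb : Color} where

    alice-reuses-bobs-color : ColorsWithinParts ((b , cb) ∷ h) → ∀ {j} → Uncolored ((b , cb) ∷ h) (proj₁ b , j) →
                              CanMove ((b , cb) ∷ h) alice
    alice-reuses-bobs-color within {j} u =
      ((proj₁ b , j) , cb) , step2 ((proj₂ b , cb , here refl) , j , u) refl u ,
      legal-reuse within u (proj₂ b , here refl)

    alice-continues-part : ColorsWithinParts ((b , cb) ∷ h) → ¬ PartPartial ((b , cb) ∷ h) (proj₁ b) →
                           ∀ {i} → PartPartial ((b , cb) ∷ h) i → CanMove ((b , cb) ∷ h) alice
    alice-continues-part within bobPartDone {i} partial@((j₀ , c , p) , j , u) =
      ((i , j) , c) , step3 bobPartDone partial u (j₀ , p) , legal-reuse within u (j₀ , p)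

    alice-opens-part : (∀ i → NearlyBalanced ((b , cb) ∷ h) i) → Even (sumF (coloredCount ((b , cb) ∷ h))) →
                       Odd (sumF r) → sumF (λ i → ⌈ r i /2⌉) ≤ m → (∀ i → ¬ PartPartial ((b , cb) ∷ h) i) →
                       CanMove ((b , cb) ∷ h) alice
    alice-opens-part nb even odd budget noPartial =
      let i , (unc , oddᵢ) , least = argmin-∃ (λ i → partUncolored? _ i ×-dec odd? (r i)) r
                                              (odd-uncolored-part even odd noPartial)
          c , new = new-color-available nb budget (colorCount-uncolored unc) (odd⇒Fin oddᵢ)
      in ((i , odd⇒Fin oddᵢ) , c) ,
         step4 (noPartial (proj₁ b)) noPartial (unc , oddᵢ , λ i′ unc′ odd′ → least i′ (unc′ , odd′)) new ,
         legal-new (unc _) new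

  alice-can-move : ∀ {h} → ColorsWithinParts h → (∀ i → NearlyBalanced h i) →
                   Even (sumF (coloredCount h)) → Odd (sumF r) →
                   sumF (λ i → ⌈ r i /2⌉) ≤ m → CanMove h alice
  alice-can-move {[]} _ nb _ odd budget =
    let i , oddᵢ , least = argmin-∃ (odd? ∘ r) r (odd-sumF r odd)
        c , new = new-color-available nb budget (colorCount-uncolored partUncolored-[]) (odd⇒Fin oddᵢ)
    in ((i , odd⇒Fin oddᵢ) , c) , step1 (oddᵢ , least) new , legal-new (partUncolored-[] _) new
  alice-can-move {(b , cb) ∷ h} within nb even odd budget =
    answer (any? (λ j → ¬? (colored? _ (proj₁ b , j)))) (any? (partPartial? _))
    where
    -- The decisions are passed as arguments rather than scrutinised with 'with', which would
    -- abstract them in the large types of nb and even and make type checking very slow.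
    answer : Dec (∃ λ j → Uncolored ((b , cb) ∷ h) (proj₁ b , j)) →
             Dec (∃ (PartPartial ((b , cb) ∷ h))) → CanMove ((b , cb) ∷ h) alice
    answer (yes (_ , u))    _                   = alice-reuses-bobs-color within u
    answer (no bobPartFull) (yes (_ , partial)) = alice-continues-part within (bobPartFull ∘ proj₂) partial
    answer (no _)           (no noPartial)      = alice-opens-part nb even odd budget (λ i p → noPartial (i , p))

  can-move : ∀ {h p} → Odd (sumF r) → sumF (λ i → ⌈ r i /2⌉) ≤ m → Reach h p → ∃ (Uncolored h) → CanMove h p
  can-move {p = alice} odd budget R _ =
    alice-can-move (reach-colorsWithinParts R) (nearlyBalanced-at-alice R)
                   (subst Even (sym (reach-sumF-coloredCount R)) (length-at-alice R)) odd budget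
  can-move {p = bob} odd budget R uncolored =
    bob-can-move (reach-colorsWithinParts R) (balanced⇒nearlyBalanced ∘ balanced-at-bob R) budget uncolored

lemma4 : ∀ {k} (r : Fin k → ℕ) (m : ℕ) →
    3 ≤ k →
    (∀ i → 1 ≤ r i) →
    (∀ i j → i Data.Fin.≤ j → r j ≤ r i) →
    (∃ λ i → 2 ≤ r i) →
    Odd (sumF r) →
    sumF (λ i → ⌈ r i /2⌉) ≤ m →
    ∀ h p → Game.Reach r m h p → Game.AllColored r m h ⊎ Game.CanMove r m h p
lemma4 r m _ _ _ _ odd budget h p R with allColored⊎uncolored r m h
... | inj₁ allColored = inj₁ allColored
... | inj₂ uncolored  = inj₂ (can-move r m odd budget R uncolored)
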